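{- Let $G=(V,E)$ be a graph, $u,v\in V$ distinct, let $\mathcal{H}=\{H_1,\dots,H_k\}$ be a $uv$-compatible family with $H_i\cap H_j=\{u,v\}$ for all $1\le i<j\le k$, and let $Y\subseteq V$ with $|Y|\ge4$, $Y\cap\{u,v\}=\emptyset$ and $|Y\cap H_i|\le1$ for all $1\le i\le k$. Suppose that $|Y\cap H_i|=|Y\cap H_j|=1$ for some pair $1\le i<j\le k$. Then there is a $uv$-compatible family $\mathcal{H}'$ with $\mathrm{cov}(\mathcal{H})\cup\mathrm{cov}(Y)\subseteq\mathrm{cov}(\mathcal{H}')$ and $\mathrm{val}(\mathcal{H}')\le\mathrm{val}(\mathcal{H})+\mathrm{val}(Y)$. Furthermore, if $G$ is $uv$-sparse and $\mathcal{H}$ and $Y$ are both tight, then $\mathcal{H}'$ is tight and $|H_i|=|H_j|=3$.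
   Context: Graphs are finite and simple. $i(X)$ counts edges with both ends in $X\subseteq V$; for a family $\mathcal{S}$ of subsets, $i(\mathcal{S})$ counts edges with both ends in some member, $\mathrm{cov}(\mathcal{S})=\{(x,y):x,y\in V,\{x,y\}\subseteq S\text{ for some }S\in\mathcal{S}\}$, $\mathrm{cov}(Y)=\mathrm{cov}(\{Y\})$. For nonempty $H\subseteq V$, $\mathrm{val}(H)=2|H|-t_H$ with $t_H=4$ if $H=\{u,v\}$, $t_H=3$ if $H\ne\{u,v\}$ and $|H|\in\{2,3\}$, $t_H=2$ otherwise. $\mathcal{H}$ is $uv$-compatible if each member contains $u,v$ and has size $\ge3$; $\mathrm{val}(\mathcal{H})=\sum_j\mathrm{val}(H_j)-2(k-1)$. $G$ is $uv$-sparse if $i(H)\le\mathrm{val}(H)$ for all $H\subseteq V$ with $|H|\ge2$ and $i(\mathcal{H})\le\mathrm{val}(\mathcal{H})$ for all $uv$-compatible $\mathcal{H}$. Sets ($|H|\ge2$) and families are tight when $i=\mathrm{val}$. -}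

module Defs where

open import Data.Nat as ℕ using (ℕ; _<ᵇ_; _≡ᵇ_; _≤_)
open import Data.Integer as ℤ using (ℤ; +_; _-_)
open import Data.Bool using (Bool; true; false; _∧_; _∨_; if_then_else_)
open import Data.Fin using (Fin; toℕ)
open import Data.Fin.Subset using (Subset; _∈_; ∣_∣; ⁅_⁆; _∪_)
open import Data.Vec using (lookup)
open import Data.Vec.Properties using (≡-dec)
import Data.Bool.Properties as BoolP
open import Data.List as List using (List; length; foldr; allFin)
open import Data.Nat.ListAction using (sum)
open import Data.Bool.ListAction using (any)
open import Data.List.Membership.Propositional as LM using ()
open import Data.List.Relation.Unary.Unique.Propositional using (Unique)
open import Data.List.Relation.Unary.All using (All)
open import Data.Product using (Σ; _×_; ∃-syntax)
open import Relation.Binary.PropositionalEquality using (_≡_)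
open import Relation.Nullary using (yes; no)

record Graph (n : ℕ) : Set where
  field
    adj    : Fin n → Fin n → Bool
    sym    : ∀ x y → adj x y ≡ adj y x
    irrefl : ∀ x → adj x x ≡ false
open Graph public

pairCount : {n : ℕ} → (Fin n → Fin n → Bool) → ℕ
pairCount {n} f =
  sum (List.map (λ x → sum (List.map (λ y →
    if (toℕ x <ᵇ toℕ y) ∧ f x y then 1 else 0) (allFin n))) (allFin n))

iSet : {n : ℕ} → Graph n → Subset n → ℕ
iSet G X = pairCount (λ x y → adj G x y ∧ lookup X x ∧ lookup X y)

iFam : {n : ℕ} → Graph n → List (Subset n) → ℕ
iFam G 𝓗 = pairCount (λ x y → adj G x y ∧ any (λ S → lookup S x ∧ lookup S y) 𝓗)

InCovFam : {n : ℕ} → List (Subset n) → Fin n → Fin n → Set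
InCovFam 𝓗 x y = ∃[ S ] (S LM.∈ 𝓗 × x ∈ S × y ∈ S)

InCovSet : {n : ℕ} → Subset n → Fin n → Fin n → Set
InCovSet Y x y = x ∈ Y × y ∈ Y

tval : {n : ℕ} → Fin n → Fin n → Subset n → ℕ
tval u v H with ≡-dec BoolP._≟_ H (⁅ u ⁆ ∪ ⁅ v ⁆)
... | yes _ = 4
... | no _  = if (∣ H ∣ ≡ᵇ 2) ∨ (∣ H ∣ ≡ᵇ 3) then 3 else 2

-- val(H) = 2|H| - t_H   (used for nonempty H)
val : {n : ℕ} → Fin n → Fin n → Subset n → ℤ
val u v H = + (2 ℕ.* ∣ H ∣) - + tval u v H

valFam : {n : ℕ} → Fin n → Fin n → List (Subset n) → ℤ
valFam u v 𝓗 =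
  foldr (λ H acc → val u v H ℤ.+ acc) (+ 0) 𝓗 - (+ 2) ℤ.* (+ length 𝓗 - + 1)

Compatible : {n : ℕ} → Fin n → Fin n → List (Subset n) → Set
Compatible u v 𝓗 = Unique 𝓗 × All (λ H → u ∈ H × v ∈ H × 3 ≤ ∣ H ∣) 𝓗

UVSparse : {n : ℕ} → Graph n → Fin n → Fin n → Set
UVSparse {n} G u v =
  (∀ (H : Subset n) → 2 ≤ ∣ H ∣ → + iSet G H ℤ.≤ val u v H) ×
  (∀ (𝓗 : List (Subset n)) → Compatible u v 𝓗 → + iFam G 𝓗 ℤ.≤ valFam u v 𝓗)

TightSet : {n : ℕ} → Graph n → Fin n → Fin n → Subset n → Set
TightSet G u v H = 2 ≤ ∣ H ∣ × + iSet G H ≡ val u v H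

TightFam : {n : ℕ} → Graph n → Fin n → Fin n → List (Subset n) → Set
TightFam G u v 𝓗 = + iFam G 𝓗 ≡ valFam u v 𝓗

module Submission where

-- Replace Hᵢ and Hⱼ by U = Hᵢ ∪ Hⱼ ∪ Y. As Hᵢ ∩ Hⱼ = {u, v} and Y meets Hᵢ ∪ Hⱼ in at least
-- two points, inclusion–exclusion gives |Hᵢ| + |Hⱼ| + |Y| = |U| + 4 + e with e ≥ 0, whence
-- val(𝓗) + val(Y) = val(𝓗′) + s with slack s = 2e + (3 − t_Hᵢ) + (3 − t_Hⱼ) ≥ 0.
-- An edge inside Y and inside a member of 𝓗 would give that member two vertices of Y, so
-- i(𝓗) + i(Y) ≤ i(𝓗′). If G is uv-sparse and 𝓗, Y are tight, then
-- val(𝓗′) + s = i(𝓗) + i(Y) ≤ i(𝓗′) ≤ val(𝓗′): thus 𝓗′ is tight and s = 0, so t_Hᵢ = t_Hⱼ = 3,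
-- which for sets of size at least 3 means |Hᵢ| = |Hⱼ| = 3.

open import Defs hiding (sym)
open import Data.Bool using (Bool; true; false; T; _∧_; _∨_; if_then_else_)
open import Data.Bool.ListAction using (any)
import Data.Bool.Properties as Bool
open import Data.Empty using (⊥; ⊥-elim)
open import Data.Fin using (Fin; toℕ) renaming (_<_ to _<ᶠ_)
open import Data.Fin.Subset using (Subset; _∈_; _∉_; _∩_; _∪_; ⁅_⁆; ∣_∣; _⊆_; Nonempty)
open import Data.Fin.Subset.Properties
  using ( ∣⁅x⁆∣≡1; ∣⊥∣≡0; Empty-unique; nonempty?; p⊆q⇒∣p∣≤∣q∣; p⊆p∪q; q⊆p∪q
        ; x∈p∩q⁺; x∈p∩q⁻; x∈p∪q⁻; x∈⁅y⁆⇒x≡y; ∩-idem )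
open import Data.Integer as ℤ using (ℤ; +_; -_; _+_; _-_; _*_)
import Data.Integer.Properties as ℤ
import Algebra.Properties.CommutativeSemigroup ℤ.+-commutativeSemigroup as ℤ+
open import Data.Integer.Tactic.RingSolver as ℤ-Solver using ()
open import Data.List as List using (List; []; _∷_; _++_; length; lookup; foldr; allFin)
open import Data.List.Membership.Propositional using (find; lose) renaming (_∈_ to _∈ₗ_)
open import Data.List.Membership.Propositional.Properties using (∈-∃++; ∈-lookup)
open import Data.List.Relation.Binary.Permutation.Propositional as ↭ using (_↭_; ↭-sym; ↭⇒↭ₛ)
open import Data.List.Relation.Binary.Permutation.Propositional.Properties using (shift; ∈-resp-↭; All-resp-↭; ↭-length)
import Data.List.Relation.Binary.Permutation.Setoid.Properties as Setoid↭
open import Data.List.Relation.Unary.All as All using (_∷_)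
open import Data.List.Relation.Unary.AllPairs using (_∷_)
open import Data.List.Relation.Unary.Any using (here; there; index)
open import Data.List.Relation.Unary.Any.Properties using (any⁺; any⁻; lookup-index)
open import Data.Nat as ℕ using (ℕ; suc; _≤_; _<_; _∸_; _<ᵇ_; _≡ᵇ_; z≤n; s≤s)
open import Data.Nat.ListAction using (sum)
import Data.Nat.Properties as ℕ
open import Data.Nat.Tactic.RingSolver as ℕ-Solver using ()
open import Algebra.Properties.CommutativeSemigroup ℕ.+-commutativeSemigroup using (xy∙z≈xz∙y; interchange)
open import Data.Product using (_×_; _,_; proj₂; ∃-syntax)
open import Data.Sum as Sum using (_⊎_; inj₁; inj₂)
open import Data.Vec using ([]; _∷_) renaming (lookup to lookupᵛ)
open import Data.Vec.Properties using (≡-dec; []=⇒lookup; lookup⇒[]=)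
open import Function using (_∘_; _⇔_; mk⇔; Equivalence)
open import Relation.Nullary using (yes; no; contradiction)
open import Relation.Binary.PropositionalEquality as ≡
  using (_≡_; _≢_; refl; sym; trans; cong; cong₂; subst; module ≡-Reasoning)

open Equivalence using (to; from)

private variable
  n : ℕ

∣p∪q∣+∣p∩q∣≡∣p∣+∣q∣ : (p q : Subset n) → ∣ p ∪ q ∣ ℕ.+ ∣ p ∩ q ∣ ≡ ∣ p ∣ ℕ.+ ∣ q ∣
∣p∪q∣+∣p∩q∣≡∣p∣+∣q∣ []          []          = refl
∣p∪q∣+∣p∩q∣≡∣p∣+∣q∣ (true ∷ p)  (true ∷ q)  =
  cong suc (trans (ℕ.+-suc _ _) (trans (cong suc (∣p∪q∣+∣p∩q∣≡∣p∣+∣q∣ p q)) (sym (ℕ.+-suc _ _))))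
∣p∪q∣+∣p∩q∣≡∣p∣+∣q∣ (true ∷ p)  (false ∷ q) = cong suc (∣p∪q∣+∣p∩q∣≡∣p∣+∣q∣ p q)
∣p∪q∣+∣p∩q∣≡∣p∣+∣q∣ (false ∷ p) (true ∷ q)  = trans (cong suc (∣p∪q∣+∣p∩q∣≡∣p∣+∣q∣ p q)) (sym (ℕ.+-suc _ _))
∣p∪q∣+∣p∩q∣≡∣p∣+∣q∣ (false ∷ p) (false ∷ q) = ∣p∪q∣+∣p∩q∣≡∣p∣+∣q∣ p q

∣⁅x⁆∪⁅y⁆∣≤2 : (x y : Fin n) → ∣ ⁅ x ⁆ ∪ ⁅ y ⁆ ∣ ≤ 2
∣⁅x⁆∪⁅y⁆∣≤2 x y = begin
  ∣ ⁅ x ⁆ ∪ ⁅ y ⁆ ∣                        ≤⟨ ℕ.m≤m+n _ _ ⟩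
  ∣ ⁅ x ⁆ ∪ ⁅ y ⁆ ∣ ℕ.+ ∣ ⁅ x ⁆ ∩ ⁅ y ⁆ ∣ ≡⟨ ∣p∪q∣+∣p∩q∣≡∣p∣+∣q∣ ⁅ x ⁆ ⁅ y ⁆ ⟩
  ∣ ⁅ x ⁆ ∣ ℕ.+ ∣ ⁅ y ⁆ ∣                  ≡⟨ cong₂ ℕ._+_ (∣⁅x⁆∣≡1 x) (∣⁅x⁆∣≡1 y) ⟩
  2                                          ∎
  where open ℕ.≤-Reasoning

∣⁅x⁆∪⁅y⁆∣≡2 : {x y : Fin n} → x ≢ y → ∣ ⁅ x ⁆ ∪ ⁅ y ⁆ ∣ ≡ 2
∣⁅x⁆∪⁅y⁆∣≡2 {n} {x} {y} x≢y = begin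
  ∣ ⁅ x ⁆ ∪ ⁅ y ⁆ ∣                        ≡⟨ ℕ.+-identityʳ _ ⟨
  ∣ ⁅ x ⁆ ∪ ⁅ y ⁆ ∣ ℕ.+ 0                   ≡⟨ cong (∣ ⁅ x ⁆ ∪ ⁅ y ⁆ ∣ ℕ.+_) ∣⁅x⁆∩⁅y⁆∣≡0 ⟨
  ∣ ⁅ x ⁆ ∪ ⁅ y ⁆ ∣ ℕ.+ ∣ ⁅ x ⁆ ∩ ⁅ y ⁆ ∣ ≡⟨ ∣p∪q∣+∣p∩q∣≡∣p∣+∣q∣ ⁅ x ⁆ ⁅ y ⁆ ⟩
  ∣ ⁅ x ⁆ ∣ ℕ.+ ∣ ⁅ y ⁆ ∣                  ≡⟨ cong₂ ℕ._+_ (∣⁅x⁆∣≡1 x) (∣⁅x⁆∣≡1 y) ⟩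
  2                                          ∎
  where
  open ≡-Reasoning
  ∣⁅x⁆∩⁅y⁆∣≡0 : ∣ ⁅ x ⁆ ∩ ⁅ y ⁆ ∣ ≡ 0
  ∣⁅x⁆∩⁅y⁆∣≡0 = trans (cong ∣_∣ (Empty-unique λ (z , z∈⁅x⁆∩⁅y⁆) →
    let z∈⁅x⁆ , z∈⁅y⁆ = x∈p∩q⁻ _ _ z∈⁅x⁆∩⁅y⁆
    in x≢y (trans (sym (x∈⁅y⁆⇒x≡y x z∈⁅x⁆)) (x∈⁅y⁆⇒x≡y y z∈⁅y⁆)))) (∣⊥∣≡0 n)

x≢y⇒2≤∣p∣ : {x y : Fin n} {p : Subset n} → x ≢ y → x ∈ p → y ∈ p → 2 ≤ ∣ p ∣
x≢y⇒2≤∣p∣ {x = x} {y} {p} x≢y x∈p y∈p =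
  subst (_≤ ∣ p ∣) (∣⁅x⁆∪⁅y⁆∣≡2 x≢y) (p⊆q⇒∣p∣≤∣q∣ ⁅x⁆∪⁅y⁆⊆p)
  where
  ⁅x⁆∪⁅y⁆⊆p : ⁅ x ⁆ ∪ ⁅ y ⁆ ⊆ p
  ⁅x⁆∪⁅y⁆⊆p z∈ with x∈p∪q⁻ ⁅ x ⁆ ⁅ y ⁆ z∈
  ... | inj₁ z∈⁅x⁆ = subst (_∈ p) (sym (x∈⁅y⁆⇒x≡y x z∈⁅x⁆)) x∈p
  ... | inj₂ z∈⁅y⁆ = subst (_∈ p) (sym (x∈⁅y⁆⇒x≡y y z∈⁅y⁆)) y∈p

0<∣p∣⇒Nonempty : {p : Subset n} → 0 < ∣ p ∣ → Nonempty p
0<∣p∣⇒Nonempty {n} {p} 0<∣p∣ with nonempty? p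
... | yes p≢∅ = p≢∅
... | no  p≡∅ = contradiction (trans (cong ∣_∣ (Empty-unique p≡∅)) (∣⊥∣≡0 n)) (ℕ.>⇒≢ 0<∣p∣)

module _ {A : Set} where

  ∈⇒↭∷ : {x : A} {xs : List A} → x ∈ₗ xs → ∃[ ys ] xs ↭ x ∷ ys
  ∈⇒↭∷ x∈xs with ys , zs , refl ← ∈-∃++ x∈xs = ys ++ zs , shift _ ys zs

  ∈⇒↭∷∷ : {x y : A} {xs : List A} → x ∈ₗ xs → y ∈ₗ xs → y ≢ x → ∃[ zs ] xs ↭ x ∷ y ∷ zs
  ∈⇒↭∷∷ x∈xs y∈xs y≢x with ys , xs↭x∷ys ← ∈⇒↭∷ x∈xs with ∈-resp-↭ xs↭x∷ys y∈xs
  ... | here y≡x    = contradiction y≡x y≢x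
  ... | there y∈ys with zs , ys↭y∷zs ← ∈⇒↭∷ y∈ys = zs , ↭.trans xs↭x∷ys (↭.prep _ ys↭y∷zs)

  ∀-lookup⇒∀-∈ : {xs : List A} (P : A → Set) → (∀ i → P (lookup xs i)) → ∀ {x} → x ∈ₗ xs → P x
  ∀-lookup⇒∀-∈ P P[xsᵢ] x∈xs = subst P (sym (lookup-index x∈xs)) (P[xsᵢ] (index x∈xs))

module _ (u v : Fin n) where

  Compatible-resp-↭ : {𝓗 𝓗′ : List (Subset n)} → 𝓗 ↭ 𝓗′ → Compatible u v 𝓗 → Compatible u v 𝓗′
  Compatible-resp-↭ 𝓗↭𝓗′ (unique , members) =
    Setoid↭.Unique-resp-↭ (≡.setoid _) (↭⇒↭ₛ 𝓗↭𝓗′) unique , All-resp-↭ 𝓗↭𝓗′ members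

  private
    sumVal : List (Subset n) → ℤ
    sumVal = foldr (λ H acc → val u v H + acc) (+ 0)

    sumVal-resp-↭ : {𝓗 𝓗′ : List (Subset n)} → 𝓗 ↭ 𝓗′ → sumVal 𝓗 ≡ sumVal 𝓗′
    sumVal-resp-↭ ↭.refl                 = refl
    sumVal-resp-↭ (↭.prep H 𝓗↭𝓗′)       = cong (λ s → val u v H + s) (sumVal-resp-↭ 𝓗↭𝓗′)
    sumVal-resp-↭ (↭.swap H H′ 𝓗↭𝓗′)    =
      trans (cong (λ s → val u v H + (val u v H′ + s)) (sumVal-resp-↭ 𝓗↭𝓗′))
            (ℤ+.x∙yz≈y∙xz (val u v H) (val u v H′) _)
    sumVal-resp-↭ (↭.trans 𝓗↭𝓗″ 𝓗″↭𝓗′) = trans (sumVal-resp-↭ 𝓗↭𝓗″) (sumVal-resp-↭ 𝓗″↭𝓗′)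

  valFam-resp-↭ : {𝓗 𝓗′ : List (Subset n)} → 𝓗 ↭ 𝓗′ → valFam u v 𝓗 ≡ valFam u v 𝓗′
  valFam-resp-↭ 𝓗↭𝓗′ = cong₂ (λ s k → s - + 2 * (+ k - + 1)) (sumVal-resp-↭ 𝓗↭𝓗′) (↭-length 𝓗↭𝓗′)

  valFam-∷ : (H : Subset n) (𝓗 : List (Subset n)) → valFam u v (H ∷ 𝓗) ≡ val u v H + valFam u v 𝓗 - + 2
  valFam-∷ H 𝓗 = regroup (val u v H) (sumVal 𝓗) (+ length 𝓗)
    where
    regroup : ∀ x s k → x + s - + 2 * (+ 1 + k - + 1) ≡ x + (s - + 2 * (k - + 1)) - + 2
    regroup = ℤ-Solver.solve-∀

InCovFam-resp-↭ : {𝓗 𝓗′ : List (Subset n)} {x y : Fin n} → 𝓗 ↭ 𝓗′ → InCovFam 𝓗 x y → InCovFam 𝓗′ x y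
InCovFam-resp-↭ 𝓗↭𝓗′ (S , S∈𝓗 , x∈S , y∈S) = S , ∈-resp-↭ 𝓗↭𝓗′ S∈𝓗 , x∈S , y∈S

module _ (u v : Fin n) where

  3≤∣H∣⇒H≢⁅u⁆∪⁅v⁆ : {H : Subset n} → 3 ≤ ∣ H ∣ → H ≢ ⁅ u ⁆ ∪ ⁅ v ⁆
  3≤∣H∣⇒H≢⁅u⁆∪⁅v⁆ 3≤∣H∣ refl = ℕ.<⇒≱ 3≤∣H∣ (∣⁅x⁆∪⁅y⁆∣≤2 u v)

  H∩H′≡⁅u⁆∪⁅v⁆⇒H′≢H : {𝓗 : List (Subset n)} {H H′ : Subset n} → Compatible u v 𝓗 → H ∈ₗ 𝓗 →
                       H ∩ H′ ≡ ⁅ u ⁆ ∪ ⁅ v ⁆ → H′ ≢ H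
  H∩H′≡⁅u⁆∪⁅v⁆⇒H′≢H {H = H} (_ , members) H∈𝓗 H∩H′≡uv refl =
    3≤∣H∣⇒H≢⁅u⁆∪⁅v⁆ (proj₂ (proj₂ (All.lookup members H∈𝓗))) (trans (sym (∩-idem H)) H∩H′≡uv)

  tval-≥3 : (H : Subset n) → 3 ≤ ∣ H ∣ →
            (∣ H ∣ ≡ 3 × tval u v H ≡ 3) ⊎ (4 ≤ ∣ H ∣ × tval u v H ≡ 2)
  tval-≥3 H 3≤∣H∣ with ≡-dec Bool._≟_ H (⁅ u ⁆ ∪ ⁅ v ⁆)
  ... | yes H≡uv = contradiction H≡uv (3≤∣H∣⇒H≢⁅u⁆∪⁅v⁆ 3≤∣H∣)
  ... | no _     = bySize ∣ H ∣ 3≤∣H∣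
    where
    bySize : ∀ k → 3 ≤ k → (k ≡ 3 × (if (k ≡ᵇ 2) ∨ (k ≡ᵇ 3) then 3 else 2) ≡ 3)
                         ⊎ (4 ≤ k × (if (k ≡ᵇ 2) ∨ (k ≡ᵇ 3) then 3 else 2) ≡ 2)
    bySize 1                         (s≤s ())
    bySize 2                         (s≤s (s≤s ()))
    bySize 3                         _ = inj₁ (refl , refl)
    bySize (suc (suc (suc (suc k)))) _ = inj₂ (s≤s (s≤s (s≤s (s≤s z≤n))) , refl)

  tval-≥4 : (H : Subset n) → 4 ≤ ∣ H ∣ → tval u v H ≡ 2
  tval-≥4 H 4≤∣H∣ with tval-≥3 H (ℕ.≤-trans (ℕ.n≤1+n 3) 4≤∣H∣)
  ... | inj₁ (∣H∣≡3 , _) = contradiction (subst (4 ≤_) ∣H∣≡3 4≤∣H∣) (ℕ.<-irrefl refl)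
  ... | inj₂ (_ , t≡2)   = t≡2

  -- For |H| ≥ 3, val H = 2|H| − 3 + surplus H.
  surplus : Subset n → ℕ
  surplus H = 3 ∸ tval u v H

  tval+surplus≡3 : (H : Subset n) → 3 ≤ ∣ H ∣ → tval u v H ℕ.+ surplus H ≡ 3
  tval+surplus≡3 H 3≤∣H∣ = ℕ.m+[n∸m]≡n tval≤3
    where
    tval≤3 : tval u v H ≤ 3
    tval≤3 with tval-≥3 H 3≤∣H∣
    ... | inj₁ (_ , t≡3) = ℕ.≤-reflexive t≡3
    ... | inj₂ (_ , t≡2) = subst (_≤ 3) (sym t≡2) (ℕ.n≤1+n 2)

  surplus≡0⇒∣H∣≡3 : (H : Subset n) → 3 ≤ ∣ H ∣ → surplus H ≡ 0 → ∣ H ∣ ≡ 3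
  surplus≡0⇒∣H∣≡3 H 3≤∣H∣ surplus≡0 with tval-≥3 H 3≤∣H∣
  ... | inj₁ (∣H∣≡3 , _) = ∣H∣≡3
  ... | inj₂ (_ , t≡2)   = contradiction (subst (λ t → 3 ∸ t ≡ 0) t≡2 surplus≡0) λ ()

  val≡2∣H∣-tval : (H : Subset n) → val u v H ≡ + 2 * + ∣ H ∣ - + tval u v H
  val≡2∣H∣-tval H = cong (_- + tval u v H) (ℤ.pos-* 2 ∣ H ∣)

  val≡2∣H∣-2 : (H : Subset n) → 4 ≤ ∣ H ∣ → val u v H ≡ + 2 * + ∣ H ∣ - + 2
  val≡2∣H∣-2 H 4≤∣H∣ = trans (val≡2∣H∣-tval H) (cong (λ t → + 2 * + ∣ H ∣ - + t) (tval-≥4 H 4≤∣H∣))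

sum-map-+-≤ : {B : Set} (f g h : B → ℕ) (xs : List B) → (∀ x → f x ℕ.+ g x ≤ h x) →
              sum (List.map f xs) ℕ.+ sum (List.map g xs) ≤ sum (List.map h xs)
sum-map-+-≤ f g h []       _     = z≤n
sum-map-+-≤ f g h (x ∷ xs) f+g≤h = begin
  (f x ℕ.+ sum (List.map f xs)) ℕ.+ (g x ℕ.+ sum (List.map g xs))
    ≡⟨ interchange (f x) _ (g x) _ ⟩
  (f x ℕ.+ g x) ℕ.+ (sum (List.map f xs) ℕ.+ sum (List.map g xs))
    ≤⟨ ℕ.+-mono-≤ (f+g≤h x) (sum-map-+-≤ f g h xs f+g≤h) ⟩
  h x ℕ.+ sum (List.map h xs) ∎
  where open ℕ.≤-Reasoning

indicator : Bool → ℕ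
indicator b = if b then 1 else 0

indicator-∧-+-≤ : ∀ c a b d → (T a → T b → ⊥) → (T a → T d) → (T b → T d) →
                  indicator (c ∧ a) ℕ.+ indicator (c ∧ b) ≤ indicator (c ∧ d)
indicator-∧-+-≤ false _     _     _     _     _   _   = z≤n
indicator-∧-+-≤ true  false false _     _     _   _   = z≤n
indicator-∧-+-≤ true  true  true  _     a∧b⇒⊥ _   _   = ⊥-elim (a∧b⇒⊥ _ _)
indicator-∧-+-≤ true  true  false true  _     _   _   = ℕ.≤-refl
indicator-∧-+-≤ true  false true  true  _     _   _   = ℕ.≤-refl
indicator-∧-+-≤ true  true  false false _     a⇒d _   = ⊥-elim (a⇒d _)
indicator-∧-+-≤ true  false true  false _     _   b⇒d = ⊥-elim (b⇒d _)

pairCount-+-≤ : (f g h : Fin n → Fin n → Bool) → (∀ x y → T (f x y) → T (g x y) → ⊥) →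
                (∀ x y → T (f x y) → T (h x y)) → (∀ x y → T (g x y) → T (h x y)) →
                pairCount f ℕ.+ pairCount g ≤ pairCount h
pairCount-+-≤ {n} f g h f∧g⇒⊥ f⇒h g⇒h =
  sum-map-+-≤ _ _ _ (allFin n) λ x → sum-map-+-≤ _ _ _ (allFin n) λ y →
    indicator-∧-+-≤ (toℕ x <ᵇ toℕ y) (f x y) (g x y) (h x y) (f∧g⇒⊥ x y) (f⇒h x y) (g⇒h x y)

∈⇔T-lookup : {x : Fin n} {S : Subset n} → x ∈ S ⇔ T (lookupᵛ S x)
∈⇔T-lookup {x = x} {S} = mk⇔ (λ x∈S → from Bool.T-≡ ([]=⇒lookup x∈S)) (λ t → lookup⇒[]= x S (to Bool.T-≡ t))

T-lookup∧⇔InCovSet : {x y : Fin n} {S : Subset n} → T (lookupᵛ S x ∧ lookupᵛ S y) ⇔ InCovSet S x y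
T-lookup∧⇔InCovSet = mk⇔
  (λ t → let tx , ty = to Bool.T-∧ t in from ∈⇔T-lookup tx , from ∈⇔T-lookup ty)
  (λ (x∈S , y∈S) → from Bool.T-∧ (to ∈⇔T-lookup x∈S , to ∈⇔T-lookup y∈S))

T-any⇔InCovFam : {x y : Fin n} {𝓗 : List (Subset n)} →
                 T (any (λ S → lookupᵛ S x ∧ lookupᵛ S y) 𝓗) ⇔ InCovFam 𝓗 x y
T-any⇔InCovFam {𝓗 = 𝓗} = mk⇔
  (λ t → let S , S∈𝓗 , tS = find (any⁻ _ 𝓗 t) in S , S∈𝓗 , to T-lookup∧⇔InCovSet tS)
  (λ (S , S∈𝓗 , x∈S , y∈S) → any⁺ _ (lose S∈𝓗 (from T-lookup∧⇔InCovSet (x∈S , y∈S))))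

T-∧-mapʳ : ∀ a {b c} → (T b → T c) → T (a ∧ b) → T (a ∧ c)
T-∧-mapʳ true b⇒c = b⇒c

adj⇒≢ : (G : Graph n) {x y : Fin n} → T (adj G x y) → x ≢ y
adj⇒≢ G {x} xy refl = subst T (irrefl G x) xy

iFam+iSet≤iFam : (G : Graph n) {𝓗 𝓗′ : List (Subset n)} {Y : Subset n} →
                 (∀ {S} → S ∈ₗ 𝓗 → ∣ Y ∩ S ∣ ≤ 1) →
                 (∀ x y → InCovFam 𝓗 x y ⊎ InCovSet Y x y → InCovFam 𝓗′ x y) →
                 iFam G 𝓗 ℕ.+ iSet G Y ≤ iFam G 𝓗′
iFam+iSet≤iFam G {𝓗} {Y = Y} ∣Y∩S∣≤1 covers = pairCount-+-≤ _ _ _ disjoint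
  (λ x y → T-∧-mapʳ (adj G x y) (from T-any⇔InCovFam ∘ covers x y ∘ inj₁ ∘ to T-any⇔InCovFam))
  (λ x y → T-∧-mapʳ (adj G x y) (from T-any⇔InCovFam ∘ covers x y ∘ inj₂ ∘ to T-lookup∧⇔InCovSet))
  where
  disjoint : ∀ x y → T (adj G x y ∧ any (λ S → lookupᵛ S x ∧ lookupᵛ S y) 𝓗) →
             T (adj G x y ∧ lookupᵛ Y x ∧ lookupᵛ Y y) → ⊥
  disjoint x y xy∈𝓗 xy∈Y =
    let xy , inS            = to (Bool.T-∧ {adj G x y}) xy∈𝓗
        S , S∈𝓗 , x∈S , y∈S = to (T-any⇔InCovFam {𝓗 = 𝓗}) inS
        x∈Y , y∈Y           = to (T-lookup∧⇔InCovSet {S = Y}) (proj₂ (to (Bool.T-∧ {adj G x y}) xy∈Y))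
    in ℕ.<-irrefl refl (ℕ.≤-trans
         (x≢y⇒2≤∣p∣ (adj⇒≢ G xy) (x∈p∩q⁺ (x∈Y , x∈S)) (x∈p∩q⁺ (y∈Y , y∈S))) (∣Y∩S∣≤1 S∈𝓗))

i+[+n]≤i⇒n≡0 : ∀ i n → i + + n ℤ.≤ i → n ≡ 0
i+[+n]≤i⇒n≡0 i n i+n≤i = ℕ.n≤0⇒n≡0 (ℤ.drop‿+≤+ (begin
  + n             ≡⟨ cancel i (+ n) ⟩
  - i + (i + + n) ≤⟨ ℤ.+-monoʳ-≤ (- i) i+n≤i ⟩
  - i + i         ≡⟨ ℤ.+-inverseˡ i ⟩
  + 0             ∎))
  where
  open ℤ.≤-Reasoning
  cancel : ∀ i j → j ≡ - i + (i + j)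
  cancel = ℤ-Solver.solve-∀

-- Both sides have the shape that valFam-∷ gives to valFam (H₁ ∷ H₂ ∷ R) + val Y and to
-- valFam (U ∷ R) + slack.
merge-identity : ∀ (a b c d e p₁ p₂ V : ℤ) {x₁ x₂ y w t₁ t₂ : ℤ} →
  x₁ ≡ + 2 * a - t₁ → x₂ ≡ + 2 * b - t₂ → y ≡ + 2 * c - + 2 → w ≡ + 2 * d - + 2 →
  a + b + c ≡ d + + 4 + e → t₁ + p₁ ≡ + 3 → t₂ + p₂ ≡ + 3 →
  x₁ + (x₂ + V - + 2) - + 2 + y ≡ w + V - + 2 + (+ 2 * e + p₁ + p₂)
merge-identity a b c d e p₁ p₂ V {t₁ = t₁} {t₂} refl refl refl refl abc tp₁ tp₂ = begin
  (+ 2 * a - t₁) + ((+ 2 * b - t₂) + V - + 2) - + 2 + (+ 2 * c - + 2)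
    ≡⟨ collect a b c t₁ t₂ p₁ p₂ V ⟩
  (+ 2 * (a + b + c) - (t₁ + p₁) - (t₂ + p₂)) + (p₁ + p₂ + V - + 6)
    ≡⟨ cong (_+ (p₁ + p₂ + V - + 6)) balance ⟩
  (+ 2 * (d + + 4 + e) - + 3 - + 3) + (p₁ + p₂ + V - + 6)
    ≡⟨ spread d e p₁ p₂ V ⟩
  (+ 2 * d - + 2) + V - + 2 + (+ 2 * e + p₁ + p₂)  ∎
  where
  open ≡-Reasoning
  collect : ∀ a b c t₁ t₂ p₁ p₂ V →
    (+ 2 * a - t₁) + ((+ 2 * b - t₂) + V - + 2) - + 2 + (+ 2 * c - + 2)
      ≡ (+ 2 * (a + b + c) - (t₁ + p₁) - (t₂ + p₂)) + (p₁ + p₂ + V - + 6)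
  collect = ℤ-Solver.solve-∀
  spread : ∀ d e p₁ p₂ V →
    (+ 2 * (d + + 4 + e) - + 3 - + 3) + (p₁ + p₂ + V - + 6)
      ≡ (+ 2 * d - + 2) + V - + 2 + (+ 2 * e + p₁ + p₂)
  spread = ℤ-Solver.solve-∀
  balance : + 2 * (a + b + c) - (t₁ + p₁) - (t₂ + p₂) ≡ + 2 * (d + + 4 + e) - + 3 - + 3
  balance = trans (cong (λ s → + 2 * s - (t₁ + p₁) - (t₂ + p₂)) abc)
                  (cong₂ (λ r s → + 2 * (d + + 4 + e) - r - s) tp₁ tp₂)

tight-by-merge : (G : Graph n) {u v : Fin n} {𝓗 𝓗′ : List (Subset n)} {Y : Subset n} {s : ℕ} →
                 UVSparse G u v → Compatible u v 𝓗′ →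
                 (∀ {S} → S ∈ₗ 𝓗 → ∣ Y ∩ S ∣ ≤ 1) →
                 (∀ x y → InCovFam 𝓗 x y ⊎ InCovSet Y x y → InCovFam 𝓗′ x y) →
                 valFam u v 𝓗 + val u v Y ≡ valFam u v 𝓗′ + + s →
                 TightFam G u v 𝓗 → TightSet G u v Y → TightFam G u v 𝓗′ × s ≡ 0
tight-by-merge G {u} {v} {𝓗} {𝓗′} {Y} {s} (_ , sparse) compatible′ ∣Y∩S∣≤1 covers merge tight𝓗 (_ , tightY) =
  ℤ.≤-antisym i′≤V′ (ℤ.≤-trans (ℤ.i≤i+j _ (+ s)) V′+s≤i′) , i+[+n]≤i⇒n≡0 _ s (ℤ.≤-trans V′+s≤i′ i′≤V′)
  where
  i′≤V′ : + iFam G 𝓗′ ℤ.≤ valFam u v 𝓗′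
  i′≤V′ = sparse 𝓗′ compatible′
  V′+s≤i′ : valFam u v 𝓗′ + + s ℤ.≤ + iFam G 𝓗′
  V′+s≤i′ = begin
    valFam u v 𝓗′ + + s       ≡⟨ merge ⟨
    valFam u v 𝓗 + val u v Y  ≡⟨ cong₂ _+_ tight𝓗 tightY ⟨
    + iFam G 𝓗 + + iSet G Y   ≤⟨ ℤ.+≤+ (iFam+iSet≤iFam G ∣Y∩S∣≤1 covers) ⟩
    + iFam G 𝓗′               ∎
    where open ℤ.≤-Reasoning

module Merge {u v : Fin n} (u≢v : u ≢ v) {𝓗 R : List (Subset n)} {H₁ H₂ Y : Subset n}
  (compatible : Compatible u v 𝓗) (𝓗↭H₁∷H₂∷R : 𝓗 ↭ H₁ ∷ H₂ ∷ R)
  (H₁∩H₂≡uv : H₁ ∩ H₂ ≡ ⁅ u ⁆ ∪ ⁅ v ⁆)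
  (4≤∣Y∣ : 4 ≤ ∣ Y ∣) (u∉Y : u ∉ Y) (v∉Y : v ∉ Y)
  (∣Y∩S∣≤1 : ∀ {S} → S ∈ₗ 𝓗 → ∣ Y ∩ S ∣ ≤ 1)
  (∣Y∩H₁∣≡1 : ∣ Y ∩ H₁ ∣ ≡ 1) (∣Y∩H₂∣≡1 : ∣ Y ∩ H₂ ∣ ≡ 1) where

  U : Subset n
  U = (H₁ ∪ H₂) ∪ Y

  H₁⊆U : H₁ ⊆ U
  H₁⊆U x∈H₁ = p⊆p∪q Y (p⊆p∪q H₂ x∈H₁)

  H₂⊆U : H₂ ⊆ U
  H₂⊆U x∈H₂ = p⊆p∪q Y (q⊆p∪q H₁ H₂ x∈H₂)

  Y⊆U : Y ⊆ U
  Y⊆U = q⊆p∪q (H₁ ∪ H₂) Y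

  4≤∣U∣ : 4 ≤ ∣ U ∣
  4≤∣U∣ = ℕ.≤-trans 4≤∣Y∣ (p⊆q⇒∣p∣≤∣q∣ Y⊆U)

  compatible₀ : Compatible u v (H₁ ∷ H₂ ∷ R)
  compatible₀ = Compatible-resp-↭ u v 𝓗↭H₁∷H₂∷R compatible

  3≤∣H₁∣ : 3 ≤ ∣ H₁ ∣
  3≤∣H₁∣ = proj₂ (proj₂ (All.head (proj₂ compatible₀)))

  3≤∣H₂∣ : 3 ≤ ∣ H₂ ∣
  3≤∣H₂∣ = proj₂ (proj₂ (All.head (All.tail (proj₂ compatible₀))))

  U∉R : ∀ {S} → S ∈ₗ R → U ≢ S
  U∉R S∈R refl = contradiction (ℕ.≤-trans 4≤∣Y∣ (ℕ.≤-trans (p⊆q⇒∣p∣≤∣q∣ Y⊆Y∩U) ∣Y∩U∣≤1)) λ { (s≤s ()) }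
    where
    Y⊆Y∩U : Y ⊆ Y ∩ U
    Y⊆Y∩U x∈Y = x∈p∩q⁺ (x∈Y , Y⊆U x∈Y)
    ∣Y∩U∣≤1 : ∣ Y ∩ U ∣ ≤ 1
    ∣Y∩U∣≤1 = ∣Y∩S∣≤1 (∈-resp-↭ (↭-sym 𝓗↭H₁∷H₂∷R) (there (there S∈R)))

  compatible′ : Compatible u v (U ∷ R)
  compatible′ = replace compatible₀
    where
    replace : Compatible u v (H₁ ∷ H₂ ∷ R) → Compatible u v (U ∷ R)
    replace (_ ∷ _ ∷ unique , (u∈H₁ , v∈H₁ , _) ∷ _ ∷ members) =
      All.tabulate U∉R ∷ unique , (H₁⊆U u∈H₁ , H₁⊆U v∈H₁ , ℕ.≤-trans (ℕ.n≤1+n 3) 4≤∣U∣) ∷ members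

  covers : ∀ x y → InCovFam 𝓗 x y ⊎ InCovSet Y x y → InCovFam (U ∷ R) x y
  covers x y = covers₀ ∘ Sum.map₁ (InCovFam-resp-↭ 𝓗↭H₁∷H₂∷R)
    where
    covers₀ : InCovFam (H₁ ∷ H₂ ∷ R) x y ⊎ InCovSet Y x y → InCovFam (U ∷ R) x y
    covers₀ (inj₁ (_ , here refl         , x∈H₁ , y∈H₁)) = U , here refl , H₁⊆U x∈H₁ , H₁⊆U y∈H₁
    covers₀ (inj₁ (_ , there (here refl) , x∈H₂ , y∈H₂)) = U , here refl , H₂⊆U x∈H₂ , H₂⊆U y∈H₂
    covers₀ (inj₁ (S , there (there S∈R)   , x∈S , y∈S))   = S , there S∈R , x∈S , y∈S
    covers₀ (inj₂ (x∈Y , y∈Y))                            = U , here refl , Y⊆U x∈Y , Y⊆U y∈Y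

  2≤∣[H₁∪H₂]∩Y∣ : 2 ≤ ∣ (H₁ ∪ H₂) ∩ Y ∣
  2≤∣[H₁∪H₂]∩Y∣ =
    let y₁ , y₁∈Y∩H₁ = 0<∣p∣⇒Nonempty (ℕ.≤-reflexive (sym ∣Y∩H₁∣≡1))
        y₂ , y₂∈Y∩H₂ = 0<∣p∣⇒Nonempty (ℕ.≤-reflexive (sym ∣Y∩H₂∣≡1))
        y₁∈Y , y₁∈H₁ = x∈p∩q⁻ Y H₁ y₁∈Y∩H₁
        y₂∈Y , y₂∈H₂ = x∈p∩q⁻ Y H₂ y₂∈Y∩H₂
    in x≢y⇒2≤∣p∣ (y₁≢y₂ y₁∈Y y₁∈H₁ y₂∈H₂)
                 (x∈p∩q⁺ (p⊆p∪q H₂ y₁∈H₁ , y₁∈Y)) (x∈p∩q⁺ (q⊆p∪q H₁ H₂ y₂∈H₂ , y₂∈Y))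
    where
    y₁≢y₂ : ∀ {y₁ y₂} → y₁ ∈ Y → y₁ ∈ H₁ → y₂ ∈ H₂ → y₁ ≢ y₂
    y₁≢y₂ y₁∈Y y₁∈H₁ y₂∈H₂ refl
      with x∈p∪q⁻ ⁅ u ⁆ ⁅ v ⁆ (subst (_ ∈_) H₁∩H₂≡uv (x∈p∩q⁺ (y₁∈H₁ , y₂∈H₂)))
    ... | inj₁ y₁∈⁅u⁆ = u∉Y (subst (_∈ Y) (x∈⁅y⁆⇒x≡y u y₁∈⁅u⁆) y₁∈Y)
    ... | inj₂ y₁∈⁅v⁆ = v∉Y (subst (_∈ Y) (x∈⁅y⁆⇒x≡y v y₁∈⁅v⁆) y₁∈Y)

  excess : ℕ
  excess = ∣ (H₁ ∪ H₂) ∩ Y ∣ ∸ 2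

  ∣H₁∣+∣H₂∣+∣Y∣≡∣U∣+4+excess : ∣ H₁ ∣ ℕ.+ ∣ H₂ ∣ ℕ.+ ∣ Y ∣ ≡ ∣ U ∣ ℕ.+ 4 ℕ.+ excess
  ∣H₁∣+∣H₂∣+∣Y∣≡∣U∣+4+excess = begin
    ∣ H₁ ∣ ℕ.+ ∣ H₂ ∣ ℕ.+ ∣ Y ∣
      ≡⟨ cong (ℕ._+ ∣ Y ∣) (∣p∪q∣+∣p∩q∣≡∣p∣+∣q∣ H₁ H₂) ⟨
    ∣ H₁ ∪ H₂ ∣ ℕ.+ ∣ H₁ ∩ H₂ ∣ ℕ.+ ∣ Y ∣
      ≡⟨ cong (λ k → ∣ H₁ ∪ H₂ ∣ ℕ.+ k ℕ.+ ∣ Y ∣) (trans (cong ∣_∣ H₁∩H₂≡uv) (∣⁅x⁆∪⁅y⁆∣≡2 u≢v)) ⟩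
    ∣ H₁ ∪ H₂ ∣ ℕ.+ 2 ℕ.+ ∣ Y ∣
      ≡⟨ xy∙z≈xz∙y (∣ H₁ ∪ H₂ ∣) 2 (∣ Y ∣) ⟩
    ∣ H₁ ∪ H₂ ∣ ℕ.+ ∣ Y ∣ ℕ.+ 2
      ≡⟨ cong (ℕ._+ 2) (∣p∪q∣+∣p∩q∣≡∣p∣+∣q∣ (H₁ ∪ H₂) Y) ⟨
    ∣ U ∣ ℕ.+ ∣ (H₁ ∪ H₂) ∩ Y ∣ ℕ.+ 2
      ≡⟨ cong (λ k → ∣ U ∣ ℕ.+ k ℕ.+ 2) (ℕ.m+[n∸m]≡n 2≤∣[H₁∪H₂]∩Y∣) ⟨
    ∣ U ∣ ℕ.+ (2 ℕ.+ excess) ℕ.+ 2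
      ≡⟨ regroup (∣ U ∣) excess ⟩
    ∣ U ∣ ℕ.+ 4 ℕ.+ excess ∎
    where
    open ≡-Reasoning
    regroup : ∀ d e → d ℕ.+ (2 ℕ.+ e) ℕ.+ 2 ≡ d ℕ.+ 4 ℕ.+ e
    regroup = ℕ-Solver.solve-∀

  slack : ℕ
  slack = 2 ℕ.* excess ℕ.+ surplus u v H₁ ℕ.+ surplus u v H₂

  valFam-merge : valFam u v 𝓗 + val u v Y ≡ valFam u v (U ∷ R) + + slack
  valFam-merge = begin
    valFam u v 𝓗 + val u v Y
      ≡⟨ cong (_+ val u v Y) (valFam-resp-↭ u v 𝓗↭H₁∷H₂∷R) ⟩
    valFam u v (H₁ ∷ H₂ ∷ R) + val u v Y
      ≡⟨ cong (_+ val u v Y) (trans (valFam-∷ u v H₁ (H₂ ∷ R))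
                                      (cong (λ w → val u v H₁ + w - + 2) (valFam-∷ u v H₂ R))) ⟩
    val u v H₁ + (val u v H₂ + valFam u v R - + 2) - + 2 + val u v Y
      ≡⟨ merge-identity (+ ∣ H₁ ∣) (+ ∣ H₂ ∣) (+ ∣ Y ∣) (+ ∣ U ∣) (+ excess)
           (+ surplus u v H₁) (+ surplus u v H₂) (valFam u v R)
           (val≡2∣H∣-tval u v H₁) (val≡2∣H∣-tval u v H₂) (val≡2∣H∣-2 u v Y 4≤∣Y∣) (val≡2∣H∣-2 u v U 4≤∣U∣)
           (cong +_ ∣H₁∣+∣H₂∣+∣Y∣≡∣U∣+4+excess)
           (cong +_ (tval+surplus≡3 u v H₁ 3≤∣H₁∣)) (cong +_ (tval+surplus≡3 u v H₂ 3≤∣H₂∣)) ⟩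
    val u v U + valFam u v R - + 2 + (+ 2 * + excess + + surplus u v H₁ + + surplus u v H₂)
      ≡⟨ cong₂ _+_ (valFam-∷ u v U R)
                   (cong (λ k → k + + surplus u v H₁ + + surplus u v H₂) (ℤ.pos-* 2 excess)) ⟨
    valFam u v (U ∷ R) + + slack ∎
    where open ≡-Reasoning

  valFam′≤valFam+val : valFam u v (U ∷ R) ℤ.≤ valFam u v 𝓗 + val u v Y
  valFam′≤valFam+val = ℤ.≤-trans (ℤ.i≤i+j _ (+ slack)) (ℤ.≤-reflexive (sym valFam-merge))

  slack≡0⇒∣H₁∣≡3×∣H₂∣≡3 : slack ≡ 0 → ∣ H₁ ∣ ≡ 3 × ∣ H₂ ∣ ≡ 3
  slack≡0⇒∣H₁∣≡3×∣H₂∣≡3 slack≡0 =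
    surplus≡0⇒∣H∣≡3 u v H₁ 3≤∣H₁∣ (ℕ.m+n≡0⇒n≡0 (2 ℕ.* excess) (ℕ.m+n≡0⇒m≡0 _ slack≡0)) ,
    surplus≡0⇒∣H∣≡3 u v H₂ 3≤∣H₂∣ (ℕ.m+n≡0⇒n≡0 _ slack≡0)

lemma3p6 : {n : ℕ} (G : Graph n) (u v : Fin n) → u ≢ v →
    (𝓗 : List (Subset n)) → Compatible u v 𝓗 →
    (∀ (a b : Fin (length 𝓗)) → a <ᶠ b →
      lookup 𝓗 a ∩ lookup 𝓗 b ≡ ⁅ u ⁆ ∪ ⁅ v ⁆) →
    (Y : Subset n) → 4 ≤ ∣ Y ∣ → (u ∈ Y → ⊥) → (v ∈ Y → ⊥) →
    (∀ (a : Fin (length 𝓗)) → ∣ Y ∩ lookup 𝓗 a ∣ ≤ 1) →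
    (i j : Fin (length 𝓗)) → i <ᶠ j →
    ∣ Y ∩ lookup 𝓗 i ∣ ≡ 1 → ∣ Y ∩ lookup 𝓗 j ∣ ≡ 1 →
    ∃[ 𝓗′ ] (Compatible u v 𝓗′ ×
      (∀ x y → InCovFam 𝓗 x y ⊎ InCovSet Y x y → InCovFam 𝓗′ x y) ×
      valFam u v 𝓗′ ℤ.≤ valFam u v 𝓗 ℤ.+ val u v Y ×
      (UVSparse G u v → TightFam G u v 𝓗 → TightSet G u v Y →
        TightFam G u v 𝓗′ × ∣ lookup 𝓗 i ∣ ≡ 3 × ∣ lookup 𝓗 j ∣ ≡ 3))
lemma3p6 G u v u≢v 𝓗 compatible disjoint Y 4≤∣Y∣ u∉Y v∉Y ∣Y∩Hₐ∣≤1 i j i<j ∣Y∩Hᵢ∣≡1 ∣Y∩Hⱼ∣≡1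
  with R , 𝓗↭Hᵢ∷Hⱼ∷R ← ∈⇒↭∷∷ (∈-lookup i) (∈-lookup j)
                         (H∩H′≡⁅u⁆∪⁅v⁆⇒H′≢H u v compatible (∈-lookup i) (disjoint i j i<j))
  = U ∷ R , compatible′ , covers , valFam′≤valFam+val , tightness
  where
  ∣Y∩S∣≤1 : ∀ {S} → S ∈ₗ 𝓗 → ∣ Y ∩ S ∣ ≤ 1
  ∣Y∩S∣≤1 = ∀-lookup⇒∀-∈ (λ S → ∣ Y ∩ S ∣ ≤ 1) ∣Y∩Hₐ∣≤1

  open Merge u≢v compatible 𝓗↭Hᵢ∷Hⱼ∷R (disjoint i j i<j) 4≤∣Y∣ u∉Y v∉Y ∣Y∩S∣≤1 ∣Y∩Hᵢ∣≡1 ∣Y∩Hⱼ∣≡1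

  tightness : UVSparse G u v → TightFam G u v 𝓗 → TightSet G u v Y →
              TightFam G u v (U ∷ R) × ∣ lookup 𝓗 i ∣ ≡ 3 × ∣ lookup 𝓗 j ∣ ≡ 3
  tightness sparse tight𝓗 tightY =
    let tight′ , slack≡0 = tight-by-merge G sparse compatible′ ∣Y∩S∣≤1 covers valFam-merge tight𝓗 tightY
    in tight′ , slack≡0⇒∣H₁∣≡3×∣H₂∣≡3 slack≡0
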